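{- Let $G$ be a $(P_5,\textit{HVN})$-free graph containing an induced $T$-5-wheel $\Sigma$, with the notation below, and assume that $\bar R_4\cup\bar R_{4,x}=\emptyset$. Then $$V(G)=N_G(x)\cup R_1\cup R_3\cup R_4\cup\bar R_1\cup\bar R_3\cup Y_2\cup Y_5\cup P^2\cup P^3\cup P^4\cup T\cup S,$$ and $$N_G(x)=R_{1,x}\cup R_{2,x}\cup R_{5,x}\cup\bar R_{1,x}\cup\bar R_{3,x}\cup Y_{1,x}\cup P^{3,x}.$$
   Context: Graphs are finite, simple and connected. $P_5$ is the path on 5 vertices; an HVN is a $K_4$ plus a vertex adjacent to exactly two vertices of the $K_4$; $(H_1,H_2)$-free means no induced $H_1$ or $H_2$. A $T$-5-wheel is an induced cycle $C=v_1v_2v_3v_4v_5v_1$ together with a vertex $x$ adjacent to exactly $v_1,v_2,v_5$ on $C$; here $\Sigma$ is such an induced subgraph of $G$. Indices are modulo 5. For $u\in V(G)$, $N_C(u)$ and $N_\Sigma(u)$ denote the sets of neighbours of $u$ in $V(C)$ and in $V(\Sigma)$, and $N_G(x)$ the neighbourhood of $x$. For $i\in\{1,\dots,5\}$, among vertices $u$ with $ux\notin E(G)$ (this includes $x$ itself): $R_i=\{u: N_C(u)=\{v_{i-1},v_{i+1}\}\}$, $\bar R_i=\{u: N_C(u)=\{v_{i-1},v_i,v_{i+1}\}\}$, $Y_i=\{u: N_C(u)=\{v_{i-2},v_i,v_{i+2}\}\}$, $P^i=\{u: N_C(u)=\{v_{i-1},v_i,v_{i+1},v_{i+2}\}\}$,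 $T=\{u: N_C(u)=V(C)\}$. Further $S=\{u: N_\Sigma(u)=\emptyset\}$, $R_{i,x}=\{u: N_\Sigma(u)=\{v_{i-1},v_{i+1},x\}\}$, $\bar R_{i,x}=\{u: N_\Sigma(u)=\{v_{i-1},v_i,v_{i+1},x\}\}$, $Y_{i,x}=\{u: N_\Sigma(u)=\{v_{i-2},v_i,v_{i+2},x\}\}$, $P^{i,x}=\{u:N_\Sigma(u)=\{v_{i-1},v_i,v_{i+1},v_{i+2},x\}\}$. -}

module Defs where

open import Data.Nat using (ℕ)
open import Data.Fin using (Fin; zero; suc; _≟_)
open import Data.Bool using (Bool; true; false; _∨_; _∧_; not)
open import Data.Product using (Σ; ∃; _×_; _,_)
open import Data.Sum using (_⊎_)
open import Relation.Nullary using (¬_)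
open import Relation.Nullary.Decidable using (⌊_⌋)
open import Relation.Binary.PropositionalEquality using (_≡_; _≢_)
open import Function.Definitions using (Injective)

record Graph : Set where
  field
    n     : ℕ
    adj   : Fin n → Fin n → Bool
    sym   : ∀ u w → adj u w ≡ adj w u
    irrefl : ∀ u → adj u u ≡ false

  V : Set
  V = Fin n

  E : V → V → Set
  E u w = adj u w ≡ true

open Graph public

data Reach (G : Graph) : V G → V G → Set where
  here : ∀ {u} → Reach G u u
  step : ∀ {u w t} → E G u w → Reach G w t → Reach G u t

Connected : Graph → Set
Connected G = ∀ u w → Reach G u w

HasInduced : (G : Graph) (k : ℕ) (H : Fin k → Fin k → Bool) → Set
HasInduced G k H =
  Σ (Fin k → V G) λ f →
    Injective _≡_ _≡_ f × (∀ i j → i ≢ j → adj G (f i) (f j) ≡ H i j)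

private
  eqb : ∀ {k} → Fin k → Fin k → Bool
  eqb i j = ⌊ i ≟ j ⌋

P5adj : Fin 5 → Fin 5 → Bool
P5adj zero (suc zero) = true
P5adj (suc zero) zero = true
P5adj (suc zero) (suc (suc zero)) = true
P5adj (suc (suc zero)) (suc zero) = true
P5adj (suc (suc zero)) (suc (suc (suc zero))) = true
P5adj (suc (suc (suc zero))) (suc (suc zero)) = true
P5adj (suc (suc (suc zero))) (suc (suc (suc (suc zero)))) = true
P5adj (suc (suc (suc (suc zero)))) (suc (suc (suc zero))) = true
P5adj _ _ = false

-- HVN: K4 on {0,1,2,3} plus vertex 4 adjacent exactly to 0 and 1
HVNadj : Fin 5 → Fin 5 → Bool
HVNadj (suc (suc (suc (suc zero)))) zero = true
HVNadj (suc (suc (suc (suc zero)))) (suc zero) = true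
HVNadj (suc (suc (suc (suc zero)))) _ = false
HVNadj zero (suc (suc (suc (suc zero)))) = true
HVNadj (suc zero) (suc (suc (suc (suc zero)))) = true
HVNadj _ (suc (suc (suc (suc zero)))) = false
HVNadj i j = not (eqb i j)

P5HVNFree : Graph → Set
P5HVNFree G = ¬ HasInduced G 5 P5adj × ¬ HasInduced G 5 HVNadj

-- Indices of the 5-cycle, modulo 5.  Paper index i ∈ {1..5} is
-- represented by the element ix i of Fin 5 (ix1 = zero, …, ix5 = 4).

ix1 ix2 ix3 ix4 ix5 : Fin 5
ix1 = zero
ix2 = suc zero
ix3 = suc (suc zero)
ix4 = suc (suc (suc zero))
ix5 = suc (suc (suc (suc zero)))

next : Fin 5 → Fin 5
next (zero) = ix2
next (suc zero) = ix3
next (suc (suc zero)) = ix4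
next (suc (suc (suc zero))) = ix5
next (suc (suc (suc (suc zero)))) = ix1

prev : Fin 5 → Fin 5
prev (zero) = ix5
prev (suc zero) = ix1
prev (suc (suc zero)) = ix2
prev (suc (suc (suc zero))) = ix3
prev (suc (suc (suc (suc zero)))) = ix4

next2 : Fin 5 → Fin 5
next2 i = next (next i)

prev2 : Fin 5 → Fin 5
prev2 i = prev (prev i)

cycAdj : Fin 5 → Fin 5 → Bool
cycAdj i j = eqb j (next i) ∨ eqb j (prev i)

xPat : Fin 5 → Bool
xPat j = eqb j ix1 ∨ eqb j ix2 ∨ eqb j ix5

record TWheel (G : Graph) : Set where
  field
    v      : Fin 5 → V G
    x      : V G
    v-inj  : Injective _≡_ _≡_ v
    x-new  : ∀ i → x ≢ v i
    C-ind  : ∀ i j → i ≢ j → adj G (v i) (v j) ≡ cycAdj i j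
    x-adj  : ∀ i → adj G x (v i) ≡ xPat i

module Sets {G : Graph} (W : TWheel G) where
  open TWheel W

  NCis : (Fin 5 → Bool) → V G → Set
  NCis pat u = ∀ j → adj G u (v j) ≡ pat j

  Nx : V G → Set
  Nx u = adj G u x ≡ true

  nonX : V G → Set
  nonX u = adj G u x ≡ false

  patR patRb patY patP : Fin 5 → Fin 5 → Bool
  patR  i j = eqb j (prev i) ∨ eqb j (next i)
  patRb i j = eqb j (prev i) ∨ eqb j i ∨ eqb j (next i)
  patY  i j = eqb j (prev2 i) ∨ eqb j i ∨ eqb j (next2 i)
  patP  i j = eqb j (prev i) ∨ eqb j i ∨ eqb j (next i) ∨ eqb j (next2 i)

  patT patS : Fin 5 → Bool
  patT j = true
  patS j = false

  -- sets of vertices non-adjacent to x (x itself included)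
  R Rb Y P : Fin 5 → V G → Set
  R  i u = nonX u × NCis (patR i) u
  Rb i u = nonX u × NCis (patRb i) u
  Y  i u = nonX u × NCis (patY i) u
  P  i u = nonX u × NCis (patP i) u

  T S : V G → Set
  T u = nonX u × NCis patT u
  S u = nonX u × NCis patS u

  Rx Rbx Yx Px : Fin 5 → V G → Set
  Rx  i u = Nx u × NCis (patR i) u
  Rbx i u = Nx u × NCis (patRb i) u
  Yx  i u = Nx u × NCis (patY i) u
  Px  i u = Nx u × NCis (patP i) u

-- Whether a vertex u lies in one of the listed sets depends only on its adjacency to x and
-- to C, i.e. on one of 64 profiles.  For every profile that is not listed (apart from R̄₄ and
-- R̄₄,ₓ, excluded by hypothesis) the seven-vertex graph Σ + u contains an induced P₅ or HVN,
-- found by exhaustive search over the 5-tuples through u.  Such a copy lifts to G even when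
-- u is itself a vertex of Σ: P₅ and HVN have no false twins, so any map realising their
-- adjacencies on distinct indices is injective.

module Submission where

open import Defs renaming (sym to adj-sym)
open import Data.Bool using (Bool; true; false)
open import Data.Bool.Properties using (¬-not) renaming (_≟_ to _≟ᵇ_)
open import Data.Fin using (Fin; zero; suc; _≟_)
open import Data.Fin.Properties using (all?; any?)
open import Data.List using (List; []; _∷_; map; concatMap; allFin)
open import Data.List.Membership.Propositional using (_∈_)
open import Data.List.Membership.Propositional.Properties using (∈-map⁺; ∈-concatMap⁺)
open import Data.List.Relation.Unary.All as All using (All)
open import Data.List.Relation.Unary.Any as Any using (Any; here; there; satisfied) renaming (any? to anyᴸ?)
open import Data.Nat using (zero; suc)
open import Data.Product using (_×_; _,_; proj₁; proj₂; map₂; ∃-syntax)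
open import Data.Sum using (_⊎_; inj₁; inj₂; [_,_])
open import Data.Vec using (Vec; []; _∷_; lookup; tabulate; insertAt)
open import Data.Vec.Properties using (lookup∘tabulate)
open import Function using (_∘_)
open import Function.Definitions using (Injective)
open import Relation.Nullary using (¬_; Dec; yes; no; ¬?; contradiction)
open import Relation.Nullary.Decidable using (_×-dec_; _⊎-dec_; _→-dec_; toWitness)
open import Relation.Binary.PropositionalEquality
  using (_≡_; _≢_; refl; sym; trans; cong; module ≡-Reasoning)

NoFalseTwins : ∀ {k} → (Fin k → Fin k → Bool) → Set
NoFalseTwins H = ∀ i j → i ≢ j → H i j ≡ true ⊎ ∃[ l ] l ≢ i × l ≢ j × H i l ≢ H j l

noFalseTwins? : ∀ {k} (H : Fin k → Fin k → Bool) → Dec (NoFalseTwins H)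
noFalseTwins? H = all? λ i → all? λ j → ¬? (i ≟ j) →-dec
  ((H i j ≟ᵇ true) ⊎-dec any? λ l → ¬? (l ≟ i) ×-dec ¬? (l ≟ j) ×-dec ¬? (H i l ≟ᵇ H j l))

P5-noFalseTwins : NoFalseTwins P5adj
P5-noFalseTwins = toWitness {a? = noFalseTwins? P5adj} _

HVN-noFalseTwins : NoFalseTwins HVNadj
HVN-noFalseTwins = toWitness {a? = noFalseTwins? HVNadj} _

module _ (G : Graph) {A : Set} {K : A → A → Bool} (f : A → V G)
         (f-adj : ∀ a c → adj G (f a) (f c) ≡ K a c) where

  induced-image : ∀ {k} {H : Fin k → Fin k → Bool} → NoFalseTwins H → (g : Fin k → A) →
                  (∀ i j → i ≢ j → K (g i) (g j) ≡ H i j) → HasInduced G k H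
  induced-image {H = H} twins g g-ind = f ∘ g , injective , fg-ind
    where
    fg-ind : ∀ i j → i ≢ j → adj G (f (g i)) (f (g j)) ≡ H i j
    fg-ind i j i≢j = trans (f-adj (g i) (g j)) (g-ind i j i≢j)

    open ≡-Reasoning

    injective : Injective _≡_ _≡_ (f ∘ g)
    injective {i} {j} fgi≡fgj with i ≟ j
    ... | yes i≡j = i≡j
    ... | no i≢j with twins i j i≢j
    ...   | inj₁ Hij = contradiction self-loop λ ()
      where
      self-loop : true ≡ false
      self-loop = begin
        true                          ≡⟨ sym Hij ⟩
        H i j                         ≡⟨ sym (fg-ind i j i≢j) ⟩
        adj G (f (g i)) (f (g j))     ≡⟨ cong (λ w → adj G w (f (g j))) fgi≡fgj ⟩
        adj G (f (g j)) (f (g j))     ≡⟨ irrefl G (f (g j)) ⟩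
        false                         ∎
    ...   | inj₂ (l , l≢i , l≢j , Hil≢Hjl) = contradiction twin Hil≢Hjl
      where
      twin : H i l ≡ H j l
      twin = begin
        H i l                         ≡⟨ sym (fg-ind i l (l≢i ∘ sym)) ⟩
        adj G (f (g i)) (f (g l))     ≡⟨ cong (λ w → adj G w (f (g l))) fgi≡fgj ⟩
        adj G (f (g j)) (f (g l))     ≡⟨ fg-ind j l (l≢j ∘ sym) ⟩
        H j l                         ∎

vectors : {A : Set} → List A → ∀ n → List (Vec A n)
vectors as zero = [] ∷ []
vectors as (suc n) = concatMap (λ a → map (a ∷_) (vectors as n)) as

picks : {A : Set} → List A → List (A × List A)
picks [] = []
picks (a ∷ as) = (a , as) ∷ map (map₂ (a ∷_)) (picks as)

arrangements : {A : Set} → List A → ∀ n → List (Vec A n)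
arrangements as zero = [] ∷ []
arrangements as (suc n) = concatMap (λ (a , rest) → map (a ∷_) (arrangements rest n)) (picks as)

∈-vectors : {A : Set} {as : List A} → (∀ a → a ∈ as) → ∀ {n} (t : Vec A n) → t ∈ vectors as n
∈-vectors complete [] = here refl
∈-vectors complete (a ∷ t) =
  ∈-concatMap⁺ _ (Any.map (λ { refl → ∈-map⁺ (a ∷_) (∈-vectors complete t) }) (complete a))

∈-booleans : ∀ b → b ∈ true ∷ false ∷ []
∈-booleans true = here refl
∈-booleans false = there (here refl)

OneOf : {A : Set} → (A → Set) → A → List A → Set
OneOf F a [] = F a
OneOf F a (b ∷ bs) = F a ⊎ OneOf F b bs

oneOf-map : {A : Set} (F F′ : A → Set) → (∀ {a} → F a → F′ a) → ∀ a as → OneOf F a as → OneOf F′ a as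
oneOf-map F F′ h a [] = h
oneOf-map F F′ h a (b ∷ bs) = [ inj₁ ∘ h , inj₂ ∘ oneOf-map F F′ h b bs ]

oneOf? : {A : Set} {F : A → Set} → (∀ a → Dec (F a)) → ∀ a as → Dec (OneOf F a as)
oneOf? F? a [] = F? a
oneOf? F? a (b ∷ bs) = F? a ⊎-dec oneOf? F? b bs

cycAdj-irrefl : ∀ i → cycAdj i i ≡ false
cycAdj-irrefl zero = refl
cycAdj-irrefl (suc zero) = refl
cycAdj-irrefl (suc (suc zero)) = refl
cycAdj-irrefl (suc (suc (suc zero))) = refl
cycAdj-irrefl (suc (suc (suc (suc zero)))) = refl

-- Σ together with one further vertex, whose adjacency to x and to C is given by a profile.
data Local : Set where
  cycle : Fin 5 → Local
  centre outsider : Local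

localAdj : Bool → Vec Bool 5 → Local → Local → Bool
localAdj ux us (cycle i) (cycle j) = cycAdj i j
localAdj ux us (cycle i) centre = xPat i
localAdj ux us (cycle i) outsider = lookup us i
localAdj ux us centre (cycle j) = xPat j
localAdj ux us centre centre = false
localAdj ux us centre outsider = ux
localAdj ux us outsider (cycle j) = lookup us j
localAdj ux us outsider centre = ux
localAdj ux us outsider outsider = false

InducedLocally : Bool → Vec Bool 5 → (Fin 5 → Fin 5 → Bool) → (Fin 5 → Local) → Set
InducedLocally ux us H g = ∀ i j → i ≢ j → localAdj ux us (g i) (g j) ≡ H i j

inducedLocally? : ∀ ux us H g → Dec (InducedLocally ux us H g)
inducedLocally? ux us H g =
  all? λ i → all? λ j → ¬? (i ≟ j) →-dec (localAdj ux us (g i) (g j) ≟ᵇ H i j)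

-- Σ itself contains no induced P5 or HVN, so only 5-tuples through the outsider are searched.
throughOutsider : List (Vec Local 5)
throughOutsider = concatMap (λ t → map (λ i → insertAt t i outsider) (allFin 5))
                            (arrangements (centre ∷ map cycle (allFin 5)) 4)

Obstructed : Bool → Vec Bool 5 → Set
Obstructed ux us =
  Any (λ t → InducedLocally ux us P5adj (lookup t) ⊎ InducedLocally ux us HVNadj (lookup t))
      throughOutsider

obstructed? : ∀ ux us → Dec (Obstructed ux us)
obstructed? ux us =
  anyᴸ? (λ t → inducedLocally? ux us P5adj (lookup t) ⊎-dec inducedLocally? ux us HVNadj (lookup t))
        throughOutsider

module Profiles {G : Graph} (W : TWheel G) where
  open Sets W

  Matches : Vec Bool 5 → (Fin 5 → Bool) → Set
  Matches us pat = ∀ j → lookup us j ≡ pat j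

  matches? : ∀ us pat → Dec (Matches us pat)
  matches? us pat = all? λ j → lookup us j ≟ᵇ pat j

  Verdict : Bool → (Fin 5 → Bool) → List (Fin 5 → Bool) → Vec Bool 5 → Set
  Verdict ux p ps us = OneOf (Matches us) p ps ⊎ Matches us (patRb ix4) ⊎ Obstructed ux us

  verdict? : ∀ ux p ps us → Dec (Verdict ux p ps us)
  verdict? ux p ps us = oneOf? (matches? us) p ps ⊎-dec matches? us (patRb ix4) ⊎-dec obstructed? ux us

  every-verdict : ∀ ux p ps → All (Verdict ux p ps) (vectors (true ∷ false ∷ []) 5) →
                  ∀ us → Verdict ux p ps us
  every-verdict ux p ps table us = All.lookup table (∈-vectors ∈-booleans us)

  nonNeighbourPatterns : List (Fin 5 → Bool)
  nonNeighbourPatterns = patR ix3 ∷ patR ix4 ∷ patRb ix1 ∷ patRb ix3 ∷ patY ix2 ∷ patY ix5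
                       ∷ patP ix2 ∷ patP ix3 ∷ patP ix4 ∷ patT ∷ patS ∷ []

  neighbourPatterns : List (Fin 5 → Bool)
  neighbourPatterns = patR ix2 ∷ patR ix5 ∷ patRb ix1 ∷ patRb ix3 ∷ patY ix1 ∷ patP ix3 ∷ []

  nonNeighbour-verdict : ∀ us → Verdict false (patR ix1) nonNeighbourPatterns us
  nonNeighbour-verdict = every-verdict false (patR ix1) nonNeighbourPatterns
    (toWitness {a? = All.all? (verdict? false (patR ix1) nonNeighbourPatterns) _} _)

  neighbour-verdict : ∀ us → Verdict true (patR ix1) neighbourPatterns us
  neighbour-verdict = every-verdict true (patR ix1) neighbourPatterns
    (toWitness {a? = All.all? (verdict? true (patR ix1) neighbourPatterns) _} _)

module Attachments {G : Graph} (free : P5HVNFree G) (W : TWheel G) where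
  open TWheel W
  open Sets W
  open Profiles W

  profile : V G → Vec Bool 5
  profile u = tabulate (adj G u ∘ v)

  lookup-profile : ∀ u j → lookup (profile u) j ≡ adj G u (v j)
  lookup-profile u = lookup∘tabulate (adj G u ∘ v)

  embed : V G → Local → V G
  embed u (cycle i) = v i
  embed u centre = x
  embed u outsider = u

  embed-adj : ∀ u a c → adj G (embed u a) (embed u c) ≡ localAdj (adj G u x) (profile u) a c
  embed-adj u (cycle i) (cycle j) with i ≟ j
  ... | yes refl = trans (irrefl G (v i)) (sym (cycAdj-irrefl i))
  ... | no i≢j = C-ind i j i≢j
  embed-adj u (cycle i) centre = trans (adj-sym G (v i) x) (x-adj i)
  embed-adj u (cycle i) outsider = trans (adj-sym G (v i) u) (sym (lookup-profile u i))
  embed-adj u centre (cycle j) = x-adj j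
  embed-adj u centre centre = irrefl G x
  embed-adj u centre outsider = adj-sym G x u
  embed-adj u outsider (cycle j) = sym (lookup-profile u j)
  embed-adj u outsider centre = refl
  embed-adj u outsider outsider = irrefl G u

  unobstructed : ∀ {ux} u → adj G u x ≡ ux → ¬ Obstructed ux (profile u)
  unobstructed u refl obs with satisfied obs
  ... | t , inj₁ p5 = proj₁ free (induced-image G (embed u) (embed-adj u) P5-noFalseTwins (lookup t) p5)
  ... | t , inj₂ hvn = proj₂ free (induced-image G (embed u) (embed-adj u) HVN-noFalseTwins (lookup t) hvn)

  matches⇒NCis : ∀ u {pat} → Matches (profile u) pat → NCis pat u
  matches⇒NCis u m j = trans (sym (lookup-profile u j)) (m j)

  classify : ∀ {ux} u → adj G u x ≡ ux → ∀ p ps → (∀ us → Verdict ux p ps us) →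
             ¬ NCis (patRb ix4) u → OneOf (λ pat → adj G u x ≡ ux × NCis pat u) p ps
  classify u ux p ps verdict notRb4 with verdict (profile u)
  ... | inj₁ m = oneOf-map (Matches (profile u)) (λ pat → adj G u x ≡ _ × NCis pat u)
                           (λ m → ux , matches⇒NCis u m) p ps m
  ... | inj₂ (inj₁ m) = contradiction (matches⇒NCis u m) notRb4
  ... | inj₂ (inj₂ obs) = contradiction obs (unobstructed u ux)

lemma3p2 : (G : Graph) → Connected G → P5HVNFree G → (W : TWheel G) →
    let open Sets W in
    (∀ u → ¬ Rb ix4 u × ¬ Rbx ix4 u) →
    (∀ u → Nx u ⊎ R ix1 u ⊎ R ix3 u ⊎ R ix4 u ⊎ Rb ix1 u ⊎ Rb ix3 u
             ⊎ Y ix2 u ⊎ Y ix5 u ⊎ P ix2 u ⊎ P ix3 u ⊎ P ix4 u ⊎ T u ⊎ S u)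
    × (∀ u → Nx u → Rx ix1 u ⊎ Rx ix2 u ⊎ Rx ix5 u ⊎ Rbx ix1 u ⊎ Rbx ix3 u
                     ⊎ Yx ix1 u ⊎ Px ix3 u)
lemma3p2 G _ free W noRb4 = nonNeighbours , neighbours
  where
  open TWheel W
  open Sets W
  open Profiles W
  open Attachments free W

  nonNeighbours : ∀ u → Nx u ⊎ OneOf (λ pat → nonX u × NCis pat u) (patR ix1) nonNeighbourPatterns
  nonNeighbours u with adj G u x ≟ᵇ true
  ... | yes ux = inj₁ ux
  ... | no u≁x = inj₂ (classify u ux≡false (patR ix1) nonNeighbourPatterns nonNeighbour-verdict
                                (λ m → proj₁ (noRb4 u) (ux≡false , m)))
    where
    ux≡false : nonX u
    ux≡false = ¬-not u≁x

  neighbours : ∀ u → Nx u → OneOf (λ pat → Nx u × NCis pat u) (patR ix1) neighbourPatterns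
  neighbours u ux = classify u ux (patR ix1) neighbourPatterns neighbour-verdict
                             (λ m → proj₂ (noRb4 u) (ux , m))
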